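{- Let $P$ be a poset and $\prec$ a pre-approximating auxiliary relation on $P$. Then the collection of all $\prec$-open subsets of $P$ is a topology on $P$.
   Context: For a poset $(P,\le)$ and $X\subseteq P$, $\mathord{\uparrow}X=\{x\mid \exists y\in X,\ y\le x\}$; $X$ is upper if $X=\mathord{\uparrow}X$. A subset is directed if it is nonempty and every finite subset has an upper bound in it. An auxiliary relation on $P$ is a binary relation $\prec$ such that: $x\prec y$ implies $x\le y$; $u\le x\prec y\le z$ implies $u\prec z$; if $P$ has a least element $\bot$ then $\bot\prec x$ for all $x$. Write $s_\prec(x)=\{y\mid y\prec x\}$; $\prec$ is pre-approximating if $s_\prec(x)$ is directed for every $x\in P$. For $A\subseteq P$, $A^{\downarrow\prec}=\{x\in A\mid s_\prec(x)\cap A\ne\emptyset\}$. A subset $U\subseteq P$ is $\prec$-open if $U=\mathord{\uparrow}U$ and $U=U^{\downarrow\prec}$. -}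

module Defs where

open import Level using (Level; _⊔_; suc; Lift)
open import Data.Product using (Σ; ∃; _×_; _,_)
open import Data.Empty using (⊥)
open import Data.Unit using (⊤)
open import Data.List using (List)
open import Data.List.Relation.Unary.All using (All)
open import Relation.Unary using (Pred; _∩_; ⋃)
open import Relation.Binary using (Rel)
open import Relation.Binary.Bundles using (Poset)

module _ {c ℓ₁ ℓ₂ : Level} (P : Poset c ℓ₁ ℓ₂) where
  open Poset P renaming (Carrier to A)

  record IsAuxiliary {ℓ₃ : Level} (_≺_ : Rel A ℓ₃) : Set (c ⊔ ℓ₂ ⊔ ℓ₃) where
    field
      ≺⇒≤   : ∀ {x y} → x ≺ y → x ≤ y
      ≤≺≤   : ∀ {u x y z} → u ≤ x → x ≺ y → y ≤ z → u ≺ z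
      bot≺  : ∀ (b : A) → (∀ x → b ≤ x) → ∀ x → b ≺ x

  record Directed {ℓ : Level} (D : Pred A ℓ) : Set (c ⊔ ℓ₂ ⊔ ℓ) where
    field
      nonempty : ∃ λ x → D x
      finiteUB : ∀ (xs : List A) → All D xs → ∃ λ u → D u × All (λ x → x ≤ u) xs

  s≺ : {ℓ₃ : Level} → Rel A ℓ₃ → A → Pred A ℓ₃
  s≺ _≺_ x y = y ≺ x

  PreApproximating : {ℓ₃ : Level} → Rel A ℓ₃ → Set (c ⊔ ℓ₂ ⊔ ℓ₃)
  PreApproximating _≺_ = ∀ x → Directed (s≺ _≺_ x)

  IsUpper : {ℓ : Level} → Pred A ℓ → Set (c ⊔ ℓ₂ ⊔ ℓ)
  IsUpper U = ∀ {x y} → U x → x ≤ y → U y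

  down≺ : {ℓ₃ ℓ : Level} → Rel A ℓ₃ → Pred A ℓ → Pred A (c ⊔ ℓ₃ ⊔ ℓ)
  down≺ _≺_ U x = U x × ∃ λ y → y ≺ x × U y

  -- U = U^{↓≺}  (the inclusion U^{↓≺} ⊆ U is automatic)
  IsDownClosed≺ : {ℓ₃ ℓ : Level} → Rel A ℓ₃ → Pred A ℓ → Set (c ⊔ ℓ₃ ⊔ ℓ)
  IsDownClosed≺ _≺_ U = ∀ {x} → U x → down≺ _≺_ U x

  IsOpen≺ : {ℓ₃ ℓ : Level} → Rel A ℓ₃ → Pred A ℓ → Set (c ⊔ ℓ₂ ⊔ ℓ₃ ⊔ ℓ)
  IsOpen≺ _≺_ U = IsUpper U × IsDownClosed≺ _≺_ U

module _ {a : Level} (A : Set a) where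
  ∅ℓ : {ℓ : Level} → Pred A ℓ
  ∅ℓ _ = Lift _ ⊥

  Uℓ : {ℓ : Level} → Pred A ℓ
  Uℓ _ = Lift _ ⊤

  record IsTopology {ℓ ℓ' : Level} (𝒪 : Pred (Pred A ℓ) ℓ') : Set (a ⊔ suc ℓ ⊔ ℓ') where
    field
      empty-open  : 𝒪 ∅ℓ
      full-open   : 𝒪 Uℓ
      ∩-open      : ∀ {U V} → 𝒪 U → 𝒪 V → 𝒪 (U ∩ V)
      ⋃-open      : ∀ (I : Set ℓ) (F : I → Pred A ℓ) → (∀ i → 𝒪 (F i)) → 𝒪 (⋃ I F)

module Submission where

open import Defs
open import Level using (Level; lift)
open import Relation.Binary using (Rel)
open import Relation.Binary.Bundles using (Poset)
open import Relation.Unary using (Pred; _∩_; ⋃)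
open import Data.Product using (∃; _,_; proj₁; proj₂)
open import Data.List using ([]; _∷_)
open import Data.List.Relation.Unary.All using ([]; _∷_)
open import Data.Unit using (tt)

-- Only the directedness of each s≺(x) is used, not the auxiliary axioms:
-- nonemptiness makes the whole carrier open, and an upper bound in s≺(x) of
-- two witnesses y₁ ∈ U, y₂ ∈ V lies in U ∩ V because both sets are upper.
-- Unions of open sets are open for any relation ≺.
module _ {c ℓ₁ ℓ₂ ℓ₃ : Level} (P : Poset c ℓ₁ ℓ₂) (_≺_ : Rel (Poset.Carrier P) ℓ₃) where
  open Poset P renaming (Carrier to A)

  ∅-open : ∀ {ℓ} → IsOpen≺ P _≺_ (∅ℓ A {ℓ})
  ∅-open = (λ { (lift ()) _ }) , λ { (lift ()) }

  Uℓ-open : ∀ {ℓ} → (∀ x → ∃ λ y → y ≺ x) → IsOpen≺ P _≺_ (Uℓ A {ℓ})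
  Uℓ-open approximable = (λ _ _ → lift tt) , λ {x} _ →
    let (y , y≺x) = approximable x in lift tt , y , y≺x , lift tt

  ∩-upper : ∀ {ℓ ℓ'} {U : Pred A ℓ} {V : Pred A ℓ'} →
            IsUpper P U → IsUpper P V → IsUpper P (U ∩ V)
  ∩-upper U↑ V↑ (Ux , Vx) x≤y = U↑ Ux x≤y , V↑ Vx x≤y

  ∩-down≺ : ∀ {ℓ ℓ'} {U : Pred A ℓ} {V : Pred A ℓ'} {x} → Directed P (s≺ P _≺_ x) →
            IsUpper P U → IsUpper P V →
            down≺ P _≺_ U x → down≺ P _≺_ V x → down≺ P _≺_ (U ∩ V) x
  ∩-down≺ dir U↑ V↑ (Ux , y₁ , y₁≺x , Uy₁) (Vx , y₂ , y₂≺x , Vy₂)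
    with Directed.finiteUB dir (y₁ ∷ y₂ ∷ []) (y₁≺x ∷ y₂≺x ∷ [])
  ... | u , u≺x , y₁≤u ∷ y₂≤u ∷ [] = (Ux , Vx) , u , u≺x , U↑ Uy₁ y₁≤u , V↑ Vy₂ y₂≤u

  ∩-open : ∀ {ℓ ℓ'} {U : Pred A ℓ} {V : Pred A ℓ'} → PreApproximating P _≺_ →
           IsOpen≺ P _≺_ U → IsOpen≺ P _≺_ V → IsOpen≺ P _≺_ (U ∩ V)
  ∩-open pre (U↑ , U↓) (V↑ , V↓) =
    ∩-upper U↑ V↑ , λ {x} (Ux , Vx) → ∩-down≺ (pre x) U↑ V↑ (U↓ Ux) (V↓ Vx)

  ⋃-open : ∀ {i ℓ} (I : Set i) (F : I → Pred A ℓ) →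
           (∀ i → IsOpen≺ P _≺_ (F i)) → IsOpen≺ P _≺_ (⋃ I F)
  ⋃-open I F F-open =
    (λ (i , Fix) x≤y → i , proj₁ (F-open i) Fix x≤y) ,
    λ (i , Fix) → let (_ , y , y≺x , Fiy) = proj₂ (F-open i) Fix in (i , Fix) , y , y≺x , (i , Fiy)

theorem3p15 : ∀ {c ℓ₁ ℓ₂ ℓ₃ ℓ : Level} (P : Poset c ℓ₁ ℓ₂) (_≺_ : Rel (Poset.Carrier P) ℓ₃) →
    IsAuxiliary P _≺_ → PreApproximating P _≺_ →
    IsTopology (Poset.Carrier P) {ℓ} (IsOpen≺ P _≺_)
theorem3p15 P _≺_ _ pre = record
  { empty-open = ∅-open P _≺_
  ; full-open  = Uℓ-open P _≺_ (λ x → Directed.nonempty (pre x))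
  ; ∩-open     = ∩-open P _≺_ pre
  ; ⋃-open     = ⋃-open P _≺_
  }
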